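{- Let $p$ be a positive integer and suppose $G$ is a simple graph of order $p+2$ not containing $B_p$ as a subgraph. (1) If $p$ is even, then $G$ has size $\mathrm{ex}(p+2,B_p)$ if and only if $G=K_{p+2}-PM$ or $G=\overline{K_1+((p-2)/2)K_2+P_3}$. (2) If $p$ is odd, then $G$ has size $\mathrm{ex}(p+2,B_p)$ if and only if $G=K_1\vee (K_{p+1}-PM)$.
   Context: Graphs are finite and simple; equality of graphs means isomorphism. The book $B_p$ is the graph consisting of $p$ triangles sharing a common edge. For a graph $H$ and positive integer $n$, $\mathrm{ex}(n,H)$ is the maximum number of edges of a simple graph of order $n$ not containing $H$ as a subgraph. $G+H$ denotes the disjoint union, $mH$ the disjoint union of $m$ copies of $H$, $G\vee H$ the join (disjoint union plus all edges between $G$ and $H$), $\overline{G}$ the complement. $K_n$ is the complete graph, $P_t$ the path on $t$ vertices. For even $n$, $K_n-PM$ is the graph obtained from $K_n$ by deleting the edges of a perfect matching, i.e. the complement of $(n/2)K_2$. -}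

module Defs where

open import Data.Bool using (Bool; true; false; not; _∧_; _∨_; if_then_else_)
open import Data.Nat using (ℕ; zero; suc; _+_; _*_; _≤_; _<ᵇ_; _≡ᵇ_)
open import Data.Fin using (Fin; toℕ; splitAt; _≟_)
open import Data.List using (List; map; allFin)
open import Data.Nat.ListAction using (sum)
open import Data.Sum using (inj₁; inj₂)
open import Data.Product using (Σ; _×_)
open import Relation.Nullary using (¬_)
open import Relation.Nullary.Decidable using (⌊_⌋)
open import Relation.Binary.PropositionalEquality using (_≡_)
open import Function.Definitions using (Injective; Bijective)

record Graph (n : ℕ) : Set where
  constructor mkGraph
  field adj : Fin n → Fin n → Bool
open Graph public

IsSimple : ∀ {n} → Graph n → Set
IsSimple G = (∀ i j → adj G i j ≡ adj G j i) × (∀ i → adj G i i ≡ false)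

size : ∀ {n} → Graph n → ℕ
size {n} G = sum (map (λ i → sum (map (λ j →
  if (toℕ i <ᵇ toℕ j) ∧ adj G i j then 1 else 0) (allFin n))) (allFin n))

Contains : ∀ {k n} → Graph k → Graph n → Set
Contains H G = Σ (Fin _ → Fin _) λ f →
  Injective _≡_ _≡_ f × (∀ i j → adj H i j ≡ true → adj G (f i) (f j) ≡ true)

Iso : ∀ {m n} → Graph m → Graph n → Set
Iso G H = Σ (Fin _ → Fin _) λ f →
  Bijective _≡_ _≡_ f × (∀ i j → adj H (f i) (f j) ≡ adj G i j)

-- G (assumed H-free) has size ex(n,H): no H-free simple graph of order n has more edges
HasExSize : ∀ {k n} → Graph k → Graph n → Set
HasExSize {n = n} H G =
  (G' : Graph n) → IsSimple G' → ¬ Contains H G' → size G' ≤ size G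

complete : (n : ℕ) → Graph n
complete n = mkGraph λ i j → not ⌊ i ≟ j ⌋

complement : ∀ {n} → Graph n → Graph n
complement G = mkGraph λ i j → not ⌊ i ≟ j ⌋ ∧ not (adj G i j)

union : ∀ {m n} → Graph m → Graph n → Graph (m + n)
union {m} G H = mkGraph λ i j → go (splitAt m i) (splitAt m j)
  where
  go : _ → _ → Bool
  go (inj₁ a) (inj₁ b) = adj G a b
  go (inj₂ a) (inj₂ b) = adj H a b
  go _ _ = false

join : ∀ {m n} → Graph m → Graph n → Graph (m + n)
join {m} G H = mkGraph λ i j → go (splitAt m i) (splitAt m j)
  where
  go : _ → _ → Bool
  go (inj₁ a) (inj₁ b) = adj G a b
  go (inj₂ a) (inj₂ b) = adj H a b
  go _ _ = true

copies : ∀ {k} (t : ℕ) → Graph k → Graph (t * k)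
copies zero G = mkGraph λ ()
copies (suc t) G = union G (copies t G)

path : (t : ℕ) → Graph t
path t = mkGraph λ i j → (toℕ j ≡ᵇ suc (toℕ i)) ∨ (toℕ i ≡ᵇ suc (toℕ j))

-- book B_p: spine vertices 0,1; pages 2..p+1
book : (p : ℕ) → Graph (2 + p)
book p = mkGraph λ i j → not ⌊ i ≟ j ⌋ ∧ ((toℕ i <ᵇ 2) ∨ (toℕ j <ᵇ 2))

-- K_{2q} - PM = complement of q K_2
completeMinusPM : (q : ℕ) → Graph (q * 2)
completeMinusPM q = complement (copies q (complete 2))

module Submission where

-- Let codegree v = n − deg v count the non-neighbours of v, v itself included, so that
-- 2 e(G) + ∑ codegree = n². In order n = p + 2 a copy of B_p is exactly a pair of
-- dominating vertices, i.e. of vertices of codegree 1. In a B_p-free graph every vertex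
-- but at most one therefore has codegree at least 2, so ∑ codegree ≥ 2n − 1, and
-- ∑ codegree ≥ 2n when n is even, by parity. Both bounds are attained, so the extremal
-- graphs are those whose codegrees are tight: all equal to 2 (K_n − PM); one equal to 1
-- and the others 2 (K₁ ∨ (K_{n−1} − PM)); or one 1, one 3 and the others 2 (the
-- complement of K₁ + kK₂ + P₃). Such a graph is rebuilt up to isomorphism by repeatedly
-- splitting off a dominating vertex or a non-adjacent pair, which is joined to all the
-- remaining vertices.

open import Defs
open import Data.Bool using (Bool; true; false; not; _∧_; if_then_else_)
import Data.Bool.Properties as Bool
open import Data.Fin using (Fin; zero; suc; toℕ; _≟_; _↑ˡ_; _↑ʳ_; splitAt; punchOut)
open import Data.Fin.Permutation
  using (Permutation; Permutation′; _⟨$⟩ʳ_; _⟨$⟩ˡ_; inverseˡ; inverseʳ; permutation; transpose; flip; _∘ₚ_; lift₀; ↔⇒≡)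
open import Data.Fin.Properties
  using (any?; ¬∀⟶∃¬; injective⇒≤; punchOut-injective; toℕ-injective; ↑ˡ-injective; ↑ʳ-injective;
         splitAt-↑ˡ; splitAt-↑ʳ; splitAt⁻¹-↑ˡ; splitAt⁻¹-↑ʳ)
open import Data.List using (map; allFin; tabulate)
open import Data.List.Properties using (map-tabulate; map-cong)
import Data.Nat as ℕ
open import Data.Nat using (ℕ; zero; suc; _+_; _*_; _∸_; _≤_; _<_; z≤n; s≤s; _<ᵇ_; _≤?_)
import Data.Nat.ListAction as List
open import Data.Nat.Properties hiding (_≟_)
open import Algebra.Properties.CommutativeMonoid.Sum +-0-commutativeMonoid
  using (sum; sum-syntax; ∑-distrib-+; ∑-comm; sum-cong-≗; sum-permute)
open import Data.Nat.Tactic.RingSolver using (solve-∀)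
open import Data.Product using (Σ; _×_; _,_; proj₁; proj₂)
open import Data.Sum using (_⊎_; inj₁; inj₂)
open import Function using (_∘_)
open import Function.Bundles using (_⇔_; mk⇔; Equivalence)
open import Function.Construct.Composition as Compose using (_⇔-∘_)
open import Function.Definitions using (Injective; Bijective)
open import Relation.Binary.PropositionalEquality
open import Relation.Nullary using (¬_; yes; no; contradiction; ofʸ; ofⁿ)
open import Relation.Nullary.Decidable using (⌊_⌋)

-- Finite sums and counting

sum-const : ∀ n c → ∑[ i < n ] c ≡ n * c
sum-const zero    c = refl
sum-const (suc n) c = cong (c +_) (sum-const n c)

sum-0 : ∀ {n} {f : Fin n → ℕ} → (∀ i → f i ≡ 0) → sum f ≡ 0
sum-0 {zero}  f≡0 = refl
sum-0 {suc n} f≡0 = cong₂ _+_ (f≡0 zero) (sum-0 (f≡0 ∘ suc))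

sum-mono-≤ : ∀ {n} {f g : Fin n → ℕ} → (∀ i → f i ≤ g i) → sum f ≤ sum g
sum-mono-≤ {zero}  f≤g = z≤n
sum-mono-≤ {suc n} f≤g = +-mono-≤ (f≤g zero) (sum-mono-≤ (f≤g ∘ suc))

sum-≤⇒≗ : ∀ {n} {f g : Fin n → ℕ} → (∀ i → g i ≤ f i) → sum f ≤ sum g → ∀ i → f i ≡ g i
sum-≤⇒≗ {suc n} {f} {g} g≤f Σf≤Σg zero = ≤-antisym
  (+-cancelʳ-≤ _ _ _ (≤-trans (+-monoʳ-≤ (f zero) (sum-mono-≤ (g≤f ∘ suc))) Σf≤Σg)) (g≤f zero)
sum-≤⇒≗ {suc n} {f} {g} g≤f Σf≤Σg (suc i) = sum-≤⇒≗ (g≤f ∘ suc)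
  (+-cancelˡ-≤ (f zero) _ _ (≤-trans Σf≤Σg (+-monoˡ-≤ _ (g≤f zero)))) i

sum-↑ : ∀ m {n} (f : Fin (m + n) → ℕ) → sum f ≡ sum (f ∘ (_↑ˡ n)) + sum (f ∘ (m ↑ʳ_))
sum-↑ zero    f = refl
sum-↑ (suc m) f = trans (cong (f zero +_) (sum-↑ m (f ∘ suc))) (sym (+-assoc (f zero) _ _))

ind : Bool → ℕ
ind b = if b then 1 else 0

count : ∀ {n} → (Fin n → Bool) → ℕ
count P = sum (ind ∘ P)

δ : ∀ {n} → Fin n → Fin n → ℕ
δ a i = ind ⌊ i ≟ a ⌋

δ-refl : ∀ {n} (a : Fin n) → δ a a ≡ 1
δ-refl a with a ≟ a
... | yes _ = refl
... | no a≢a = contradiction refl a≢a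

δ-≢ : ∀ {n} {a i : Fin n} → i ≢ a → δ a i ≡ 0
δ-≢ {a = a} {i} i≢a with i ≟ a
... | yes i≡a = contradiction i≡a i≢a
... | no _ = refl

δ-suc : ∀ {n} (a i : Fin n) → δ (suc a) (suc i) ≡ δ a i
δ-suc a i with i ≟ a
... | yes _ = refl
... | no _ = refl

sum-δ : ∀ {n} (a : Fin n) → sum (δ a) ≡ 1
sum-δ {suc n} zero    = cong suc (sum-0 λ i → δ-≢ {suc n} {zero} {suc i} λ ())
sum-δ {suc n} (suc a) = trans (sum-cong-≗ (δ-suc a)) (sum-δ a)

sum-+δ : ∀ {n} (f : Fin n → ℕ) c → sum (λ i → f i + δ c i) ≡ sum f + 1
sum-+δ f c = trans (∑-distrib-+ f (δ c)) (cong (sum f +_) (sum-δ c))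

+δ-≢ : ∀ {n} {c i : Fin n} x → i ≢ c → x + δ c i ≡ x
+δ-≢ x i≢c = trans (cong (x +_) (δ-≢ i≢c)) (+-identityʳ x)

sum-≡+1⇒one-excess : ∀ {n} {f g : Fin n → ℕ} → (∀ i → g i ≤ f i) → sum f ≡ sum g + 1 →
  Σ (Fin n) λ x → ∀ i → f i ≡ g i + δ x i
sum-≡+1⇒one-excess {n} {f} {g} g≤f Σf≡Σg+1 =
  x , sum-≤⇒≗ g+δx≤f (≤-reflexive (trans Σf≡Σg+1 (sym (sum-+δ g x))))
  where
  not-equal : ¬ (∀ i → f i ≡ g i)
  not-equal f≗g = m+1+n≢m (sum g) (trans (sym Σf≡Σg+1) (sum-cong-≗ f≗g))
  excess : Σ (Fin n) λ x → f x ≢ g x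
  excess = ¬∀⟶∃¬ n _ (λ i → f i ℕ.≟ g i) not-equal
  x : Fin n
  x = proj₁ excess
  g+δx≤f : ∀ i → g i + δ x i ≤ f i
  g+δx≤f i with i ≟ x
  ... | yes refl = subst (_≤ f x) (+-comm 1 (g x)) (≤∧≢⇒< (g≤f x) (proj₂ excess ∘ sym))
  ... | no _     = subst (_≤ f i) (sym (+-identityʳ (g i))) (g≤f i)

_∖_ : ∀ {n} → (Fin n → Bool) → Fin n → Fin n → Bool
(P ∖ a) j = P j ∧ not ⌊ j ≟ a ⌋

count-false : ∀ {n} (P : Fin n → Bool) → (∀ j → P j ≡ false) → count P ≡ 0
count-false P P≡false = sum-0 (cong ind ∘ P≡false)

count-true : ∀ {n} (P : Fin n → Bool) → (∀ j → P j ≡ true) → count P ≡ n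
count-true {n} P P≡true =
  trans (sum-cong-≗ (cong ind ∘ P≡true)) (trans (sum-const n 1) (*-identityʳ n))

count-remove : ∀ {n} (P : Fin n → Bool) {a} → P a ≡ true → count P ≡ suc (count (P ∖ a))
count-remove P {a} Pa = begin
  count P                             ≡⟨ sum-cong-≗ split ⟩
  sum (λ j → ind ((P ∖ a) j) + δ a j) ≡⟨ sum-+δ (ind ∘ (P ∖ a)) a ⟩
  count (P ∖ a) + 1                   ≡⟨ +-comm (count (P ∖ a)) 1 ⟩
  suc (count (P ∖ a))                 ∎
  where
  open ≡-Reasoning
  split : ∀ j → ind (P j) ≡ ind ((P ∖ a) j) + δ a j
  split j with j ≟ a
  ... | yes refl rewrite Pa = refl
  ... | no _ with P j
  ...   | true  = refl
  ...   | false = refl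

count-∖ : ∀ {n} (P : Fin n → Bool) {a k} → P a ≡ true → count P ≡ suc k → count (P ∖ a) ≡ k
count-∖ P Pa #P≡1+k = suc-injective (trans (sym (count-remove P Pa)) #P≡1+k)

count≡0 : ∀ {n} (P : Fin n → Bool) → count P ≡ 0 → ∀ j → P j ≡ false
count≡0 P #P≡0 j with P j in Pj
... | false = refl
... | true with () ← trans (sym (count-remove P Pj)) #P≡0

count-witness : ∀ {n} (P : Fin n → Bool) {k} → count P ≡ suc k → Σ (Fin n) λ b → P b ≡ true
count-witness P #P≡1+k with any? (λ b → P b Bool.≟ true)
... | yes witness = witness
... | no none with () ← trans (sym #P≡1+k) (count-false P λ b → Bool.¬-not (λ Pb → none (b , Pb)))

count<n⇒false : ∀ {n} (P : Fin n → Bool) → count P < n → Σ (Fin n) λ j → P j ≡ false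
count<n⇒false P #P<n with any? (λ j → P j Bool.≟ false)
... | yes witness = witness
... | no none = contradiction (count-true P λ j → Bool.¬-not (λ Pj → none (j , Pj))) (<⇒≢ #P<n)

count≡n⇒true : ∀ {n} (P : Fin n → Bool) → count P ≡ n → ∀ j → P j ≡ true
count≡n⇒true {n} P #P≡n j = ind≡1 (sum-≤⇒≗ ind≤1 Σ1≤#P j)
  where
  ind≤1 : ∀ j → ind (P j) ≤ 1
  ind≤1 j with P j
  ... | true  = ≤-refl
  ... | false = z≤n
  Σ1≤#P : ∑[ j < n ] 1 ≤ count P
  Σ1≤#P = ≤-reflexive (trans (trans (sum-const n 1) (*-identityʳ n)) (sym #P≡n))
  ind≡1 : ∀ {b} → 1 ≡ ind b → b ≡ true
  ind≡1 {true} _ = refl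

count≡1⇒unique : ∀ {n} (P : Fin n → Bool) {a} → count P ≡ 1 → P a ≡ true →
  ∀ j → P j ≡ true → j ≡ a
count≡1⇒unique P {a} #P≡1 Pa j Pj with j ≟ a | count≡0 (P ∖ a) (count-∖ P Pa #P≡1) j
... | yes j≡a | _ = j≡a
... | no _    | P∖a≡false rewrite Pj with () ← P∖a≡false

unique⇒count≡1 : ∀ {n} (P : Fin n → Bool) {a} → P a ≡ true → (∀ j → P j ≡ true → j ≡ a) →
  count P ≡ 1
unique⇒count≡1 P {a} Pa unique = trans (count-remove P Pa) (cong suc (count-false (P ∖ a) outside))
  where
  outside : ∀ j → (P ∖ a) j ≡ false
  outside j with P j in Pj
  ... | false = refl
  ... | true rewrite unique j Pj with a ≟ a
  ...   | yes _ = refl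
  ...   | no a≢a = contradiction refl a≢a

count≡2⇒other : ∀ {n} (P : Fin n → Bool) {a} → count P ≡ 2 → P a ≡ true →
  Σ (Fin n) λ b → b ≢ a × P b ≡ true
count≡2⇒other P {a} #P≡2 Pa with b , b∈P∖a ← count-witness (P ∖ a) (count-∖ P Pa #P≡2) =
  b , b≢a (Bool.∧-conicalʳ _ _ b∈P∖a) , Bool.∧-conicalˡ _ _ b∈P∖a
  where
  b≢a : not ⌊ b ≟ a ⌋ ≡ true → b ≢ a
  b≢a b∉a refl with b ≟ b
  ... | yes _ = contradiction b∉a λ ()
  ... | no b≢b = b≢b refl

count≡2⇒pair : ∀ {n} (P : Fin n → Bool) {a b} → count P ≡ 2 → a ≢ b → P a ≡ true → P b ≡ true →
  ∀ j → P j ≡ true → j ≡ a ⊎ j ≡ b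
count≡2⇒pair P {a} {b} #P≡2 a≢b Pa Pb j Pj with j ≟ a
... | yes j≡a = inj₁ j≡a
... | no j≢a =
  inj₂ (count≡1⇒unique (P ∖ a) (count-∖ P Pa #P≡2) (outside b (a≢b ∘ sym) Pb) j (outside j j≢a Pj))
  where
  outside : ∀ c → c ≢ a → P c ≡ true → (P ∖ a) c ≡ true
  outside c c≢a Pc with c ≟ a
  ... | yes c≡a = contradiction c≡a c≢a
  ... | no _ rewrite Pc = refl

⌊≢⌋ : ∀ {n} {x y : Fin n} → x ≢ y → ⌊ x ≟ y ⌋ ≡ false
⌊≢⌋ {x = x} {y} x≢y with x ≟ y
... | yes x≡y = contradiction x≡y x≢y
... | no _ = refl

-- Codegrees

relabel : ∀ {m n} → Graph n → (Fin m → Fin n) → Graph m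
relabel G f = mkGraph λ i j → adj G (f i) (f j)

relabel-simple : ∀ {m n} {G : Graph n} (f : Fin m → Fin n) → IsSimple G → IsSimple (relabel G f)
relabel-simple f (adj-sym , adj-irrefl) = (λ i j → adj-sym (f i) (f j)) , adj-irrefl ∘ f

coadj : ∀ {n} → Graph n → Fin n → Fin n → Bool
coadj G i j = not (adj G i j)

codegree : ∀ {n} → Graph n → Fin n → ℕ
codegree G i = count (coadj G i)

Dominating : ∀ {n} → Graph n → Fin n → Set
Dominating G u = ∀ w → w ≢ u → adj G u w ≡ true

module _ {n} {G : Graph n} (simple : IsSimple G) where

  private
    self-non-adjacent : ∀ a → coadj G a a ≡ true
    self-non-adjacent a = cong not (proj₂ simple a)

  codegree-≥1 : ∀ a → 1 ≤ codegree G a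
  codegree-≥1 a = subst (1 ≤_) (sym (count-remove (coadj G a) (self-non-adjacent a))) (s≤s z≤n)

  codegree≡1⇒dominating : ∀ u → codegree G u ≡ 1 → Dominating G u
  codegree≡1⇒dominating u cd≡1 w w≢u with adj G u w in uw
  ... | true  = refl
  ... | false = contradiction (count≡1⇒unique (coadj G u) cd≡1 (self-non-adjacent u) w (cong not uw)) w≢u

  dominating⇒codegree≡1 : ∀ u → Dominating G u → codegree G u ≡ 1
  dominating⇒codegree≡1 u dom = unique⇒count≡1 (coadj G u) (self-non-adjacent u) only-u
    where
    only-u : ∀ w → coadj G u w ≡ true → w ≡ u
    only-u w uw with w ≟ u
    ... | yes w≡u = w≡u
    ... | no w≢u = contradiction (trans (sym uw) (cong not (dom w w≢u))) λ ()

  codegree≡2⇒non-neighbour : ∀ a → codegree G a ≡ 2 → Σ (Fin n) λ b → b ≢ a × adj G a b ≡ false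
  codegree≡2⇒non-neighbour a cd≡2 with b , b≢a , ab ← count≡2⇒other (coadj G a) cd≡2 (self-non-adjacent a) =
    b , b≢a , Bool.not-injective ab

  codegree≡2⇒adjacent : ∀ {a b} → codegree G a ≡ 2 → b ≢ a → adj G a b ≡ false →
    ∀ j → j ≢ a → j ≢ b → adj G a j ≡ true
  codegree≡2⇒adjacent {a} {b} cd≡2 b≢a ab j j≢a j≢b with adj G a j in aj
  ... | true = refl
  ... | false with count≡2⇒pair (coadj G a) cd≡2 (b≢a ∘ sym) (self-non-adjacent a) (cong not ab) j (cong not aj)
  ...   | inj₁ j≡a = contradiction j≡a j≢a
  ...   | inj₂ j≡b = contradiction j≡b j≢b

  codegree<n⇒neighbour : ∀ a → codegree G a < n → Σ (Fin n) λ j → adj G a j ≡ true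
  codegree<n⇒neighbour a cd<n with j , aj ← count<n⇒false (coadj G a) cd<n = j , Bool.not-injective aj

  codegree≡n⇒isolated : ∀ a → codegree G a ≡ n → ∀ j → adj G a j ≡ false
  codegree≡n⇒isolated a cd≡n j = Bool.not-injective (count≡n⇒true (coadj G a) cd≡n j)

-- Edges and codegrees

list-sum-allFin : ∀ {n} (h : Fin n → ℕ) → List.sum (map h (allFin n)) ≡ sum h
list-sum-allFin {n} h = trans (cong List.sum (map-tabulate (λ i → i) h)) (sum-tabulate h)
  where
  sum-tabulate : ∀ {n} (h : Fin n → ℕ) → List.sum (tabulate h) ≡ sum h
  sum-tabulate {zero}  h = refl
  sum-tabulate {suc n} h = cong (h zero +_) (sum-tabulate (h ∘ suc))

degree : ∀ {n} → Graph n → Fin n → ℕ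
degree G i = count (adj G i)

degree+codegree : ∀ {n} (G : Graph n) i → degree G i + codegree G i ≡ n
degree+codegree {n} G i = begin
  degree G i + codegree G i                        ≡⟨ ∑-distrib-+ (ind ∘ adj G i) (ind ∘ coadj G i) ⟨
  ∑[ j < n ] (ind (adj G i j) + ind (coadj G i j)) ≡⟨ sum-cong-≗ (λ j → ind+ind-not (adj G i j)) ⟩
  ∑[ j < n ] 1                                     ≡⟨ sum-const n 1 ⟩
  n * 1                                            ≡⟨ *-identityʳ n ⟩
  n                                                ∎
  where
  open ≡-Reasoning
  ind+ind-not : ∀ b → ind b + ind (not b) ≡ 1
  ind+ind-not true  = refl
  ind+ind-not false = refl

module _ {n} {G : Graph n} (simple : IsSimple G) where

  private
    forward : Fin n → Fin n → ℕ
    forward i j = ind ((toℕ i <ᵇ toℕ j) ∧ adj G i j)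

    adjacent≡forward+backward : ∀ i j → ind (adj G i j) ≡ forward i j + forward j i
    adjacent≡forward+backward i j with toℕ i <ᵇ toℕ j | <ᵇ-reflects-< (toℕ i) (toℕ j)
                                     | toℕ j <ᵇ toℕ i | <ᵇ-reflects-< (toℕ j) (toℕ i)
    ... | true  | ofʸ i<j | true  | ofʸ j<i = contradiction j<i (<-asym i<j)
    ... | true  | _       | false | _       = sym (+-identityʳ _)
    ... | false | _       | true  | _       = cong ind (proj₁ simple i j)
    ... | false | ofⁿ i≮j | false | ofⁿ j≮i with toℕ-injective (≤-antisym (≮⇒≥ j≮i) (≮⇒≥ i≮j))
    ...   | refl = cong ind (proj₂ simple i)

    size≡ : size G ≡ ∑[ i < n ] ∑[ j < n ] forward i j
    size≡ = trans (cong List.sum (map-cong (λ i → list-sum-allFin (forward i)) (allFin n)))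
                  (list-sum-allFin (λ i → ∑[ j < n ] forward i j))

  handshake : size G + size G ≡ sum (degree G)
  handshake = begin
    size G + size G
      ≡⟨ cong₂ _+_ size≡ (trans size≡ (∑-comm forward)) ⟩
    ∑[ i < n ] ∑[ j < n ] forward i j + ∑[ i < n ] ∑[ j < n ] forward j i
      ≡⟨ ∑-distrib-+ (λ i → ∑[ j < n ] forward i j) _ ⟨
    ∑[ i < n ] (∑[ j < n ] forward i j + ∑[ j < n ] forward j i)
      ≡⟨ sum-cong-≗ (λ i → sym (∑-distrib-+ (forward i) (λ j → forward j i))) ⟩
    ∑[ i < n ] ∑[ j < n ] (forward i j + forward j i)
      ≡⟨ sum-cong-≗ (λ i → sum-cong-≗ (sym ∘ adjacent≡forward+backward i)) ⟩
    sum (degree G) ∎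
    where open ≡-Reasoning

  size-codegree : size G + size G + sum (codegree G) ≡ n * n
  size-codegree = begin
    size G + size G + sum (codegree G)     ≡⟨ cong (_+ sum (codegree G)) handshake ⟩
    sum (degree G) + sum (codegree G)      ≡⟨ ∑-distrib-+ (degree G) (codegree G) ⟨
    ∑[ i < n ] (degree G i + codegree G i) ≡⟨ sum-cong-≗ (degree+codegree G) ⟩
    ∑[ i < n ] n                           ≡⟨ sum-const n n ⟩
    n * n                                  ∎
    where open ≡-Reasoning

a+a+x≡b+b+y⇒a≤b⇔y≤x : ∀ {a b x y} → a + a + x ≡ b + b + y → a ≤ b ⇔ y ≤ x
a+a+x≡b+b+y⇒a≤b⇔y≤x {a} {b} {x} {y} eq = mk⇔ to from
  where
  to : a ≤ b → y ≤ x
  to a≤b = +-cancelˡ-≤ (b + b) y x (begin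
    b + b + y ≡⟨ sym eq ⟩
    a + a + x ≤⟨ +-monoˡ-≤ x (+-mono-≤ a≤b a≤b) ⟩
    b + b + x ∎)
    where open ≤-Reasoning
  from : y ≤ x → a ≤ b
  from y≤x with a ≤? b
  ... | yes a≤b = a≤b
  ... | no a≰b = contradiction (begin-strict
    b + b + x <⟨ +-monoˡ-< x (+-mono-< (≰⇒> a≰b) (≰⇒> a≰b)) ⟩
    a + a + x ≡⟨ eq ⟩
    b + b + y ≤⟨ +-monoʳ-≤ (b + b) y≤x ⟩
    b + b + x ∎) (<-irrefl refl)
    where open ≤-Reasoning

size-≤⇔codegree-sum-≥ : ∀ {n} {G G′ : Graph n} → IsSimple G → IsSimple G′ →
  size G′ ≤ size G ⇔ sum (codegree G) ≤ sum (codegree G′)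
size-≤⇔codegree-sum-≥ simple simple′ =
  a+a+x≡b+b+y⇒a≤b⇔y≤x (trans (size-codegree simple′) (sym (size-codegree simple)))

-- ∑ codegree = n² − 2 e(G) is even when n is.
codegree-sum-even : ∀ {n} {G : Graph n} → IsSimple G → ∀ m → n ≡ 2 * m → sum (codegree G) + 1 ≢ n * 2
codegree-sum-even {G = G} simple m refl odd = even≢odd (size G + 2 * m) (m * (2 * m)) (begin
  2 * (size G + 2 * m)                     ≡⟨ regroup (size G) m ⟩
  size G + size G + 2 * m * 2              ≡⟨ cong (size G + size G +_) odd ⟨
  size G + size G + (sum (codegree G) + 1) ≡⟨ +-assoc (size G + size G) _ 1 ⟨
  size G + size G + sum (codegree G) + 1   ≡⟨ cong (_+ 1) (size-codegree simple) ⟩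
  2 * m * (2 * m) + 1                      ≡⟨ square m ⟩
  suc (2 * (m * (2 * m)))                  ∎)
  where
  open ≡-Reasoning
  regroup : ∀ e m → 2 * (e + 2 * m) ≡ e + e + 2 * m * 2
  regroup = solve-∀
  square : ∀ m → 2 * m * (2 * m) + 1 ≡ suc (2 * (m * (2 * m)))
  square = solve-∀

-- Permutations and isomorphisms

transpose-matchˡ : ∀ {n} (i j : Fin n) → transpose i j ⟨$⟩ʳ i ≡ j
transpose-matchˡ i j with i ≟ i
... | yes _ = refl
... | no i≢i = contradiction refl i≢i

transpose-other : ∀ {n} {i j k : Fin n} → k ≢ i → k ≢ j → transpose i j ⟨$⟩ʳ k ≡ k
transpose-other {i = i} {j} {k} k≢i k≢j with k ≟ i
... | yes k≡i = contradiction k≡i k≢i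
... | no _ with k ≟ j
...   | yes k≡j = contradiction k≡j k≢j
...   | no _    = refl

permutation-sending : ∀ {N} {a b : Fin (2 + N)} → a ≢ b →
  Σ (Permutation′ (2 + N)) λ σ → σ ⟨$⟩ʳ zero ≡ a × σ ⟨$⟩ʳ suc zero ≡ b
permutation-sending {N} {a} {b} a≢b = transpose (suc zero) b′ ∘ₚ τ , σ0≡a , σ1≡b
  where
  τ : Permutation′ (2 + N)
  τ = transpose zero a
  b′ : Fin (2 + N)
  b′ = τ ⟨$⟩ˡ b
  b′≢0 : b′ ≢ zero
  b′≢0 b′≡0 = a≢b (trans (sym (transpose-matchˡ zero a)) (trans (cong (τ ⟨$⟩ʳ_) (sym b′≡0)) (inverseʳ τ)))
  σ0≡a : τ ⟨$⟩ʳ (transpose (suc zero) b′ ⟨$⟩ʳ zero) ≡ a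
  σ0≡a rewrite transpose-other {i = suc zero} {b′} (λ ()) (b′≢0 ∘ sym) = transpose-matchˡ zero a
  σ1≡b : τ ⟨$⟩ʳ (transpose (suc zero) b′ ⟨$⟩ʳ suc zero) ≡ b
  σ1≡b rewrite transpose-matchˡ (suc zero) b′ = inverseʳ τ

permutation-bijective : ∀ {m n} (π : Permutation m n) → Bijective _≡_ _≡_ (π ⟨$⟩ʳ_)
permutation-bijective π =
    (λ πx≡πy → trans (sym (inverseˡ π)) (trans (cong (π ⟨$⟩ˡ_) πx≡πy) (inverseˡ π)))
  , λ y → π ⟨$⟩ˡ y , λ { refl → inverseʳ π }

bijection⇒permutation : ∀ {m n} {f : Fin m → Fin n} → Bijective _≡_ _≡_ f → Permutation m n
bijection⇒permutation {f = f} (f-inj , f-surj) =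
  permutation f (proj₁ ∘ f-surj) (λ y → proj₂ (f-surj y) refl) (λ x → f-inj (proj₂ (f-surj (f x)) refl))

Iso-trans : ∀ {l m n} {G : Graph l} {H : Graph m} {K : Graph n} → Iso G H → Iso H K → Iso G K
Iso-trans (f , f-bij , f-adj) (g , g-bij , g-adj) =
  g ∘ f , Compose.bijective _≡_ _≡_ _≡_ f-bij g-bij , λ i j → trans (g-adj (f i) (f j)) (f-adj i j)

same-adjacency⇒Iso : ∀ {n} {H K : Graph n} → (∀ i j → adj H i j ≡ adj K i j) → Iso H K
same-adjacency⇒Iso H≗K = (λ i → i) , ((λ eq → eq) , λ y → y , λ eq → eq) , λ i j → sym (H≗K i j)

simple-≗ : ∀ {n} {H K : Graph n} → (∀ i j → adj H i j ≡ adj K i j) → IsSimple K → IsSimple H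
simple-≗ H≗K (K-sym , K-irrefl) = (λ i j → trans (H≗K i j) (trans (K-sym i j) (sym (H≗K j i))))
                                , λ i → trans (H≗K i i) (K-irrefl i)

Iso-relabel : ∀ {n} (G : Graph n) (σ : Permutation′ n) → Iso G (relabel G (σ ⟨$⟩ʳ_))
Iso-relabel G σ =
  σ ⟨$⟩ˡ_ , permutation-bijective (flip σ) , λ i j → cong₂ (adj G) (inverseʳ σ) (inverseʳ σ)

codegree-relabel : ∀ {m n} (G : Graph n) (π : Permutation m n) i →
  codegree (relabel G (π ⟨$⟩ʳ_)) i ≡ codegree G (π ⟨$⟩ʳ i)
codegree-relabel G π i = sym (sum-permute (ind ∘ coadj G (π ⟨$⟩ʳ i)) π)

codegree-≗ : ∀ {n} {H K : Graph n} → (∀ i j → adj H i j ≡ adj K i j) → ∀ i → codegree H i ≡ codegree K i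
codegree-≗ H≗K i = sum-cong-≗ (cong (ind ∘ not) ∘ H≗K i)

codegree-sum-Iso : ∀ {m n} {G : Graph m} {T : Graph n} → Iso G T → sum (codegree G) ≡ sum (codegree T)
codegree-sum-Iso {m} {n} {G} {T} (f , f-bij , f-adj) = begin
  sum (codegree G)                     ≡⟨ sum-cong-≗ (codegree-≗ (λ i j → sym (f-adj i j))) ⟩
  sum (codegree (relabel T (π ⟨$⟩ʳ_))) ≡⟨ sum-cong-≗ (codegree-relabel T π) ⟩
  sum (codegree T ∘ (π ⟨$⟩ʳ_))         ≡⟨ sum-permute (codegree T) π ⟨
  sum (codegree T)                     ∎
  where
  open ≡-Reasoning
  π : Permutation m n
  π = bijection⇒permutation f-bij

Iso⇒order≡ : ∀ {m n} {G : Graph m} {T : Graph n} → Iso G T → m ≡ n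
Iso⇒order≡ (_ , f-bij , _) = ↔⇒≡ (bijection⇒permutation f-bij)

Iso⇒codegree-sum≡2n : ∀ {m n} {G : Graph m} {T : Graph n} → Iso G T →
  sum (codegree T) ≡ n * 2 → sum (codegree G) ≡ m * 2
Iso⇒codegree-sum≡2n {G = G} {T} G≅T Σ-T =
  trans (codegree-sum-Iso {G = G} {T} G≅T) (trans Σ-T (cong (_* 2) (sym (Iso⇒order≡ {G = G} {T} G≅T))))

-- Books and dominating vertices

injective⇒surjective : ∀ {n} (f : Fin n → Fin n) → Injective _≡_ _≡_ f → ∀ y → Σ (Fin n) λ x → f x ≡ y
injective⇒surjective {suc n} f f-inj y with any? (λ x → f x ≟ y)
... | yes hit = hit
... | no miss = contradiction (injective⇒≤ punchOut∘f-injective) 1+n≰n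
  where
  y≢f : ∀ x → y ≢ f x
  y≢f x y≡fx = miss (x , sym y≡fx)
  punchOut∘f-injective : Injective _≡_ _≡_ (λ x → punchOut (y≢f x))
  punchOut∘f-injective eq = f-inj (punchOut-injective (y≢f _) (y≢f _) eq)

AtMostOneDominating : ∀ {n} → Graph n → Set
AtMostOneDominating G = ∀ u v → Dominating G u → Dominating G v → u ≡ v

book-spine-edge : ∀ {p} (s : Fin 2) x → s ↑ˡ p ≢ x → adj (book p) (s ↑ˡ p) x ≡ true
book-spine-edge zero       x 0≢x rewrite ⌊≢⌋ 0≢x = refl
book-spine-edge (suc zero) x 1≢x rewrite ⌊≢⌋ 1≢x = refl

book-edge⇒≢ : ∀ {p} {i j : Fin (2 + p)} → adj (book p) i j ≡ true → i ≢ j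
book-edge⇒≢ {i = i} edge refl with i ≟ i
... | yes _ = contradiction edge λ ()
... | no i≢i = i≢i refl

-- A book B_p in a graph of order p + 2 uses every vertex, so its spine is a pair of
-- dominating vertices; conversely two dominating vertices span a B_p.
book-free⇔at-most-one-dominating : ∀ {p N} → 2 + p ≡ N → (G : Graph N) → IsSimple G →
  (¬ Contains (book p) G) ⇔ AtMostOneDominating G
book-free⇔at-most-one-dominating {p} refl G (adj-sym , _) = mk⇔ to from
  where
  spine-dominating : ∀ {f} → Injective _≡_ _≡_ f →
    (∀ i j → adj (book p) i j ≡ true → adj G (f i) (f j) ≡ true) → ∀ s → Dominating G (f (s ↑ˡ p))
  spine-dominating {f} f-inj f-adj s w w≢fs with injective⇒surjective f f-inj w
  ... | x , refl = f-adj (s ↑ˡ p) x (book-spine-edge s x λ { refl → w≢fs refl })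

  from : AtMostOneDominating G → ¬ Contains (book p) G
  from unique (f , f-inj , f-adj) =
    contradiction (f-inj (unique _ _ (spine-dominating f-inj f-adj zero) (spine-dominating f-inj f-adj (suc zero))))
                  λ ()

  to : ¬ Contains (book p) G → AtMostOneDominating G
  to book-free u v dom-u dom-v with u ≟ v
  ... | yes u≡v = u≡v
  ... | no u≢v with σ , σ0≡u , σ1≡v ← permutation-sending u≢v =
    contradiction (σ ⟨$⟩ʳ_ , (λ {x y} → σ-inj) , σ-adj) book-free
    where
    σ-inj : Injective _≡_ _≡_ (σ ⟨$⟩ʳ_)
    σ-inj = proj₁ (permutation-bijective σ)
    dom-σ0 : Dominating G (σ ⟨$⟩ʳ zero)
    dom-σ0 = subst (Dominating G) (sym σ0≡u) dom-u
    dom-σ1 : Dominating G (σ ⟨$⟩ʳ suc zero)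
    dom-σ1 = subst (Dominating G) (sym σ1≡v) dom-v
    σ-adj : ∀ i j → adj (book p) i j ≡ true → adj G (σ ⟨$⟩ʳ i) (σ ⟨$⟩ʳ j) ≡ true
    σ-adj zero             j e = dom-σ0 _ (book-edge⇒≢ e ∘ sym ∘ σ-inj)
    σ-adj (suc zero)       j e = dom-σ1 _ (book-edge⇒≢ e ∘ sym ∘ σ-inj)
    σ-adj (suc (suc i)) zero e = trans (adj-sym _ _) (dom-σ0 _ (book-edge⇒≢ e ∘ σ-inj))
    σ-adj (suc (suc i)) (suc zero) e = trans (adj-sym _ _) (dom-σ1 _ (book-edge⇒≢ e ∘ σ-inj))
    σ-adj (suc (suc i)) (suc (suc j)) e = contradiction (trans (sym (Bool.∧-zeroʳ _)) e) λ ()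

-- Codegree sums of graphs with at most one dominating vertex

-- The codegree sequences of K_n − PM, K₁ ∨ (K_{n−1} − PM), the complement of kK₂ + P₃ and
-- the complement of K₁ + kK₂ + P₃, in this order.
MatchingProfile : ∀ {n} → Graph n → Set
MatchingProfile G = ∀ i → codegree G i ≡ 2

ConeProfile : ∀ {n} → Graph n → Set
ConeProfile {n} G = Σ (Fin n) λ c → codegree G c ≡ 1 × (∀ i → i ≢ c → codegree G i ≡ 2)

PathProfile : ∀ {n} → Graph n → Set
PathProfile {n} G = Σ (Fin n) λ x → codegree G x ≡ 3 × (∀ i → i ≢ x → codegree G i ≡ 2)

ConePathProfile : ∀ {n} → Graph n → Set
ConePathProfile {n} G = Σ (Fin n) λ c → Σ (Fin n) λ x →
  x ≢ c × codegree G c ≡ 1 × codegree G x ≡ 3 × (∀ i → i ≢ c → i ≢ x → codegree G i ≡ 2)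

module _ {n} {G : Graph n} where

  matching-codegree-sum : MatchingProfile G → sum (codegree G) ≡ n * 2
  matching-codegree-sum profile = trans (sum-cong-≗ profile) (sum-const n 2)

  cone-codegree-sum : ConeProfile G → sum (codegree G) + 1 ≡ n * 2
  cone-codegree-sum (c , cd≡1 , cd≡2) = begin
    sum (codegree G) + 1                ≡⟨ sum-+δ (codegree G) c ⟨
    sum (λ i → codegree G i + δ c i)    ≡⟨ sum-cong-≗ pointwise ⟩
    ∑[ i < n ] 2                        ≡⟨ sum-const n 2 ⟩
    n * 2                               ∎
    where
    open ≡-Reasoning
    pointwise : ∀ i → codegree G i + δ c i ≡ 2
    pointwise i with i ≟ c
    ... | yes refl = cong (_+ 1) cd≡1
    ... | no i≢c   = cong (_+ 0) (cd≡2 i i≢c)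

  cone-path-codegree-sum : ConePathProfile G → sum (codegree G) ≡ n * 2
  cone-path-codegree-sum (c , x , x≢c , cd≡1 , cd≡3 , cd≡2) = +-cancelʳ-≡ 1 _ _ (begin
    sum (codegree G) + 1                ≡⟨ sum-+δ (codegree G) c ⟨
    sum (λ i → codegree G i + δ c i)    ≡⟨ sum-cong-≗ pointwise ⟩
    sum (λ i → 2 + δ x i)               ≡⟨ ∑-distrib-+ (λ _ → 2) (δ x) ⟩
    ∑[ i < n ] 2 + sum (δ x)            ≡⟨ cong₂ _+_ (sum-const n 2) (sum-δ x) ⟩
    n * 2 + 1                           ∎)
    where
    open ≡-Reasoning
    pointwise : ∀ i → codegree G i + δ c i ≡ 2 + δ x i
    pointwise i with i ≟ c | i ≟ x
    ... | yes refl | yes refl = contradiction refl x≢c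
    ... | yes refl | no _    = cong (_+ 1) cd≡1
    ... | no _    | yes refl = cong (_+ 0) cd≡3
    ... | no i≢c  | no i≢x  = cong (_+ 0) (cd≡2 i i≢c i≢x)

matching-profile⇒no-dominating : ∀ {n} {G : Graph n} → IsSimple G → MatchingProfile G → AtMostOneDominating G
matching-profile⇒no-dominating simple profile u _ dom-u _ =
  contradiction (trans (sym (profile u)) (dominating⇒codegree≡1 simple u dom-u)) λ ()

cone-profile⇒one-dominating : ∀ {n} {G : Graph n} → IsSimple G → ConeProfile G → AtMostOneDominating G
cone-profile⇒one-dominating {G = G} simple (c , _ , cd≡2) u v dom-u dom-v =
  trans (is-apex u dom-u) (sym (is-apex v dom-v))
  where
  is-apex : ∀ w → Dominating G w → w ≡ c
  is-apex w dom-w with w ≟ c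
  ... | yes w≡c = w≡c
  ... | no w≢c = contradiction (trans (sym (cd≡2 w w≢c)) (dominating⇒codegree≡1 simple w dom-w)) λ ()

data CodegreeBound {n} (G : Graph n) : Set where
  no-apex : (∀ i → 2 ≤ codegree G i) → CodegreeBound G
  apex    : ∀ c → codegree G c ≡ 1 → (∀ i → 2 ≤ codegree G i + δ c i) → CodegreeBound G

module _ {n} {G : Graph n} (simple : IsSimple G) (unique : AtMostOneDominating G) where

  codegree-bound : CodegreeBound G
  codegree-bound with any? (λ i → codegree G i ℕ.≟ 1)
  ... | no none = no-apex λ i → ≤∧≢⇒< (codegree-≥1 simple i) (λ 1≡cd → none (i , sym 1≡cd))
  ... | yes (c , cd≡1) = apex c cd≡1 bound
    where
    bound : ∀ i → 2 ≤ codegree G i + δ c i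
    bound i with i ≟ c
    ... | yes refl = ≤-reflexive (cong (_+ 1) (sym cd≡1))
    ... | no i≢c = ≤-trans (≤∧≢⇒< (codegree-≥1 simple i) λ 1≡cd → i≢c (unique i c
            (codegree≡1⇒dominating simple i (sym 1≡cd)) (codegree≡1⇒dominating simple c cd≡1))) (m≤m+n _ _)

  codegree-sum-lower-bound : n * 2 ≤ sum (codegree G) + 1
  codegree-sum-lower-bound with codegree-bound
  ... | no-apex bound = ≤-trans (≤-reflexive (sym (sum-const n 2))) (≤-trans (sum-mono-≤ bound) (m≤m+n _ 1))
  ... | apex c _ bound =
    ≤-trans (≤-reflexive (sym (sum-const n 2))) (≤-trans (sum-mono-≤ bound) (≤-reflexive (sum-+δ (codegree G) c)))

  codegree-sum-tight-odd : sum (codegree G) + 1 ≤ n * 2 → ConeProfile G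
  codegree-sum-tight-odd tight with codegree-bound
  ... | no-apex bound = contradiction (begin-strict
    sum (codegree G)     <⟨ n<1+n _ ⟩
    1 + sum (codegree G) ≡⟨ +-comm 1 _ ⟩
    sum (codegree G) + 1 ≤⟨ tight ⟩
    n * 2                ≡⟨ sum-const n 2 ⟨
    ∑[ i < n ] 2         ≤⟨ sum-mono-≤ bound ⟩
    sum (codegree G)     ∎) (<-irrefl refl)
    where open ≤-Reasoning
  ... | apex c cd≡1 bound = c , cd≡1 , λ i i≢c → trans (sym (+δ-≢ _ i≢c)) (equal i)
    where
    equal : ∀ i → codegree G i + δ c i ≡ 2
    equal = sum-≤⇒≗ bound
      (≤-trans (≤-reflexive (sum-+δ (codegree G) c)) (≤-trans tight (≤-reflexive (sym (sum-const n 2)))))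

  codegree-sum-tight-even : sum (codegree G) ≡ n * 2 → MatchingProfile G ⊎ ConePathProfile G
  codegree-sum-tight-even tight with codegree-bound
  ... | no-apex bound = inj₁ (sum-≤⇒≗ bound (≤-reflexive (trans tight (sym (sum-const n 2)))))
  ... | apex c cd≡1 bound
    with x , equal ← sum-≡+1⇒one-excess bound
                       (trans (sum-+δ (codegree G) c) (cong (_+ 1) (trans tight (sym (sum-const n 2))))) =
    inj₂ (c , x , x≢c , cd≡1 , cd≡3 , cd≡2)
    where
    x≢c : x ≢ c
    x≢c x≡c = contradiction (begin
      2                     ≡⟨ cong₂ _+_ cd≡1 (δ-refl c) ⟨
      codegree G c + δ c c  ≡⟨ equal c ⟩
      2 + δ x c             ≡⟨ cong (λ y → 2 + δ x y) x≡c ⟨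
      2 + δ x x             ≡⟨ cong (2 +_) (δ-refl x) ⟩
      3                     ∎) λ ()
      where open ≡-Reasoning
    cd≡3 : codegree G x ≡ 3
    cd≡3 = trans (sym (+δ-≢ _ x≢c)) (trans (equal x) (cong (2 +_) (δ-refl x)))
    cd≡2 : ∀ i → i ≢ c → i ≢ x → codegree G i ≡ 2
    cd≡2 i i≢c i≢x = trans (sym (+δ-≢ _ i≢c)) (trans (equal i) (+δ-≢ 2 i≢x))

codegree-sum-lower-bound-even : ∀ {n} {G : Graph n} → IsSimple G → AtMostOneDominating G →
  ∀ m → n ≡ 2 * m → n * 2 ≤ sum (codegree G)
codegree-sum-lower-bound-even {n} simple unique m n≡2m = ≤-pred (subst (suc (n * 2) ≤_) (+-comm _ 1)
  (≤∧≢⇒< (codegree-sum-lower-bound simple unique) (codegree-sum-even simple m n≡2m ∘ sym)))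

-- Joins

data Split (m : ℕ) {n : ℕ} : Fin (m + n) → Set where
  left  : (a : Fin m) → Split m (a ↑ˡ n)
  right : (j : Fin n) → Split m (m ↑ʳ j)

split : ∀ m {n} (i : Fin (m + n)) → Split m i
split m i with splitAt m i in eq
... | inj₁ a = subst (Split m) (splitAt⁻¹-↑ˡ eq) (left a)
... | inj₂ j = subst (Split m) (splitAt⁻¹-↑ʳ eq) (right j)

↑ˡ≢↑ʳ : ∀ {m n} (a : Fin m) (j : Fin n) → a ↑ˡ n ≢ m ↑ʳ j
↑ˡ≢↑ʳ {m} {n} a j eq with () ← trans (sym (splitAt-↑ˡ m a n)) (trans (cong (splitAt m) eq) (splitAt-↑ʳ m n j))

≟-injective : ∀ {m n} {f : Fin m → Fin n} → Injective _≡_ _≡_ f → ∀ a b → ⌊ f a ≟ f b ⌋ ≡ ⌊ a ≟ b ⌋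
≟-injective {f = f} f-inj a b with a ≟ b
... | yes refl with f a ≟ f a
...   | yes _ = refl
...   | no fa≢fa = contradiction refl fa≢fa
≟-injective {f = f} f-inj a b | no a≢b with f a ≟ f b
...   | yes fa≡fb = contradiction (f-inj fa≡fb) a≢b
...   | no _ = refl

module _ {m n} (H : Graph m) (T : Graph n) where

  join-adj-ˡˡ : ∀ a b → adj (join H T) (a ↑ˡ n) (b ↑ˡ n) ≡ adj H a b
  join-adj-ˡˡ a b rewrite splitAt-↑ˡ m a n | splitAt-↑ˡ m b n = refl

  join-adj-ˡʳ : ∀ a j → adj (join H T) (a ↑ˡ n) (m ↑ʳ j) ≡ true
  join-adj-ˡʳ a j rewrite splitAt-↑ˡ m a n | splitAt-↑ʳ m n j = refl

  join-adj-ʳˡ : ∀ j a → adj (join H T) (m ↑ʳ j) (a ↑ˡ n) ≡ true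
  join-adj-ʳˡ j a rewrite splitAt-↑ˡ m a n | splitAt-↑ʳ m n j = refl

  join-adj-ʳʳ : ∀ i j → adj (join H T) (m ↑ʳ i) (m ↑ʳ j) ≡ adj T i j
  join-adj-ʳʳ i j rewrite splitAt-↑ʳ m n i | splitAt-↑ʳ m n j = refl

  union-adj-ˡˡ : ∀ a b → adj (union H T) (a ↑ˡ n) (b ↑ˡ n) ≡ adj H a b
  union-adj-ˡˡ a b rewrite splitAt-↑ˡ m a n | splitAt-↑ˡ m b n = refl

  union-adj-ˡʳ : ∀ a j → adj (union H T) (a ↑ˡ n) (m ↑ʳ j) ≡ false
  union-adj-ˡʳ a j rewrite splitAt-↑ˡ m a n | splitAt-↑ʳ m n j = refl

  union-adj-ʳˡ : ∀ j a → adj (union H T) (m ↑ʳ j) (a ↑ˡ n) ≡ false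
  union-adj-ʳˡ j a rewrite splitAt-↑ˡ m a n | splitAt-↑ʳ m n j = refl

  union-adj-ʳʳ : ∀ i j → adj (union H T) (m ↑ʳ i) (m ↑ʳ j) ≡ adj T i j
  union-adj-ʳʳ i j rewrite splitAt-↑ʳ m n i | splitAt-↑ʳ m n j = refl

complement-union : ∀ {m n} (H : Graph m) (T : Graph n) i j →
  adj (complement (union H T)) i j ≡ adj (join (complement H) (complement T)) i j
complement-union {m} {n} H T i j with split m i | split m j
... | left a  | left b
  rewrite join-adj-ˡˡ (complement H) (complement T) a b | union-adj-ˡˡ H T a b
        | ≟-injective (↑ˡ-injective n _ _) a b = refl
... | left a  | right j
  rewrite join-adj-ˡʳ (complement H) (complement T) a j | union-adj-ˡʳ H T a j | ⌊≢⌋ (↑ˡ≢↑ʳ a j) = refl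
... | right i | left b
  rewrite join-adj-ʳˡ (complement H) (complement T) i b | union-adj-ʳˡ H T i b | ⌊≢⌋ (↑ˡ≢↑ʳ b i ∘ sym) = refl
... | right i | right j
  rewrite join-adj-ʳʳ (complement H) (complement T) i j | union-adj-ʳʳ H T i j
        | ≟-injective (↑ʳ-injective m _ _) i j = refl

codegree-restrict : ∀ {m N} (G : Graph (m + N)) j → (∀ a → adj G (m ↑ʳ j) (a ↑ˡ N) ≡ true) →
  codegree G (m ↑ʳ j) ≡ codegree (relabel G (m ↑ʳ_)) j
codegree-restrict {m} {N} G j adjacent-to-prefix = trans (sum-↑ m (ind ∘ coadj G (m ↑ʳ j)))
  (cong (_+ codegree (relabel G (m ↑ʳ_)) j) (count-false _ (cong not ∘ adjacent-to-prefix)))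

module _ {m n} (H : Graph m) (T : Graph n) where

  codegree-join-ˡ : ∀ a → codegree (join H T) (a ↑ˡ n) ≡ codegree H a
  codegree-join-ˡ a = begin
    codegree (join H T) (a ↑ˡ n)
      ≡⟨ sum-↑ m (ind ∘ coadj (join H T) (a ↑ˡ n)) ⟩
    count (λ b → coadj (join H T) (a ↑ˡ n) (b ↑ˡ n)) + count (λ j → coadj (join H T) (a ↑ˡ n) (m ↑ʳ j))
      ≡⟨ cong₂ _+_ (sum-cong-≗ (cong (ind ∘ not) ∘ join-adj-ˡˡ H T a))
                   (count-false _ (cong not ∘ join-adj-ˡʳ H T a)) ⟩
    codegree H a + 0
      ≡⟨ +-identityʳ _ ⟩
    codegree H a ∎
    where open ≡-Reasoning

  codegree-join-ʳ : ∀ j → codegree (join H T) (m ↑ʳ j) ≡ codegree T j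
  codegree-join-ʳ j = trans (codegree-restrict (join H T) j (join-adj-ʳˡ H T j))
                            (sum-cong-≗ (cong (ind ∘ not) ∘ join-adj-ʳʳ H T j))

  join-simple : IsSimple H → IsSimple T → IsSimple (join H T)
  join-simple (H-sym , H-irrefl) (T-sym , T-irrefl) = join-sym , join-irrefl
    where
    join-sym : ∀ i j → adj (join H T) i j ≡ adj (join H T) j i
    join-sym i j with split m i | split m j
    ... | left a  | left b  rewrite join-adj-ˡˡ H T a b | join-adj-ˡˡ H T b a = H-sym a b
    ... | left a  | right j rewrite join-adj-ˡʳ H T a j | join-adj-ʳˡ H T j a = refl
    ... | right i | left b  rewrite join-adj-ˡʳ H T b i | join-adj-ʳˡ H T i b = refl
    ... | right i | right j rewrite join-adj-ʳʳ H T i j | join-adj-ʳʳ H T j i = T-sym i j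
    join-irrefl : ∀ i → adj (join H T) i i ≡ false
    join-irrefl i with split m i
    ... | left a  = trans (join-adj-ˡˡ H T a a) (H-irrefl a)
    ... | right j = trans (join-adj-ʳʳ H T j j) (T-irrefl j)

liftBy : ∀ m {N n} → Permutation N n → Permutation (m + N) (m + n)
liftBy zero    π = π
liftBy (suc m) π = lift₀ (liftBy m π)

liftBy-↑ˡ : ∀ m {N n} (π : Permutation N n) (a : Fin m) → liftBy m π ⟨$⟩ʳ (a ↑ˡ N) ≡ a ↑ˡ n
liftBy-↑ˡ (suc m) π zero    = refl
liftBy-↑ˡ (suc m) π (suc a) = cong suc (liftBy-↑ˡ m π a)

liftBy-↑ʳ : ∀ m {N n} (π : Permutation N n) (j : Fin N) → liftBy m π ⟨$⟩ʳ (m ↑ʳ j) ≡ m ↑ʳ (π ⟨$⟩ʳ j)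
liftBy-↑ʳ zero    π j = refl
liftBy-↑ʳ (suc m) π j = cong suc (liftBy-↑ʳ m π j)

join-Iso : ∀ {m N n} {G : Graph (m + N)} (H : Graph m) {T : Graph n} → IsSimple G →
  (∀ a b → adj G (a ↑ˡ N) (b ↑ˡ N) ≡ adj H a b) →
  (∀ a j → adj G (a ↑ˡ N) (m ↑ʳ j) ≡ true) →
  Iso (relabel G (m ↑ʳ_)) T → Iso G (join H T)
join-Iso {m} {N} {n} {G} H {T} (adj-sym , _) prefix≗H prefix-dominates (f , f-bij , f-adj) =
  liftBy m π ⟨$⟩ʳ_ , permutation-bijective (liftBy m π) , adjacency
  where
  π : Permutation N n
  π = bijection⇒permutation f-bij
  adjacency : ∀ i j → adj (join H T) (liftBy m π ⟨$⟩ʳ i) (liftBy m π ⟨$⟩ʳ j) ≡ adj G i j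
  adjacency i j with split m i | split m j
  ... | left a  | left b  rewrite liftBy-↑ˡ m π a | liftBy-↑ˡ m π b =
    trans (join-adj-ˡˡ H T a b) (sym (prefix≗H a b))
  ... | left a  | right j rewrite liftBy-↑ˡ m π a | liftBy-↑ʳ m π j =
    trans (join-adj-ˡʳ H T a (f j)) (sym (prefix-dominates a j))
  ... | right i | left b  rewrite liftBy-↑ʳ m π i | liftBy-↑ˡ m π b =
    trans (join-adj-ʳˡ H T (f i) b) (sym (trans (adj-sym _ _) (prefix-dominates b i)))
  ... | right i | right j rewrite liftBy-↑ʳ m π i | liftBy-↑ʳ m π j =
    trans (join-adj-ʳʳ H T (f i) (f j)) (f-adj i j)

-- The extremal graphs

pathComplement : ∀ k → Graph (k * 2 + 3)
pathComplement k = complement (union (copies k (complete 2)) (path 3))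

conePathComplement : ∀ k → Graph (1 + (k * 2 + 3))
conePathComplement k = complement (union (complete 1) (union (copies k (complete 2)) (path 3)))

-- Stated for a two-vertex first summand, where Fin ((2 + b) + c) and Fin (2 + (b + c))
-- coincide definitionally.
union-assoc₂ : ∀ {b c} (H : Graph 2) (B : Graph b) (C : Graph c) i j →
  adj (union (union H B) C) i j ≡ adj (union H (union B C)) i j
union-assoc₂ {b} H B C i j with split 2 i | split 2 j
... | left zero       | left zero       = refl
... | left zero       | left (suc zero) = refl
... | left (suc zero) | left zero       = refl
... | left (suc zero) | left (suc zero) = refl
... | left a  | right y = trans (mixed a y) (sym (union-adj-ˡʳ H (union B C) a y))
  where
  mixed : ∀ a y → adj (union (union H B) C) (a ↑ˡ _) (2 ↑ʳ y) ≡ false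
  mixed a y with splitAt b y
  mixed zero       y | inj₁ _ = refl
  mixed zero       y | inj₂ _ = refl
  mixed (suc zero) y | inj₁ _ = refl
  mixed (suc zero) y | inj₂ _ = refl
union-assoc₂ {b} H B C _ _ | right x | left a = trans (mixed x a) (sym (union-adj-ʳˡ H (union B C) x a))
  where
  mixed : ∀ x a → adj (union (union H B) C) (2 ↑ʳ x) (a ↑ˡ _) ≡ false
  mixed x a with splitAt b x
  mixed x zero       | inj₁ _ = refl
  mixed x zero       | inj₂ _ = refl
  mixed x (suc zero) | inj₁ _ = refl
  mixed x (suc zero) | inj₂ _ = refl
union-assoc₂ {b} H B C _ _ | right x | right y with splitAt b x | splitAt b y
...   | inj₁ _ | inj₁ _ = refl
...   | inj₁ _ | inj₂ _ = refl
...   | inj₂ _ | inj₁ _ = refl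
...   | inj₂ _ | inj₂ _ = refl

completeMinusPM-join : ∀ k i j →
  adj (completeMinusPM (suc k)) i j ≡ adj (join (complement (complete 2)) (completeMinusPM k)) i j
completeMinusPM-join k = complement-union (complete 2) (copies k (complete 2))

pathComplement-join : ∀ k i j →
  adj (pathComplement (suc k)) i j ≡ adj (join (complement (complete 2)) (pathComplement k)) i j
pathComplement-join k i j = trans
  (cong (not ⌊ i ≟ j ⌋ ∧_) (cong not (union-assoc₂ (complete 2) (copies k (complete 2)) (path 3) i j)))
  (complement-union (complete 2) (union (copies k (complete 2)) (path 3)) i j)

module _ {m n} (H : Graph m) (T : Graph n) where

  join-matching-profile : MatchingProfile H → MatchingProfile T → MatchingProfile (join H T)
  join-matching-profile H-profile T-profile i with split m i
  ... | left a  = trans (codegree-join-ˡ H T a) (H-profile a)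
  ... | right j = trans (codegree-join-ʳ H T j) (T-profile j)

  join-path-profile : MatchingProfile H → PathProfile T → PathProfile (join H T)
  join-path-profile H-profile (x , cd≡3 , cd≡2) = m ↑ʳ x , trans (codegree-join-ʳ H T x) cd≡3 , others
    where
    others : ∀ i → i ≢ m ↑ʳ x → codegree (join H T) i ≡ 2
    others i i≢x with split m i
    ... | left a  = trans (codegree-join-ˡ H T a) (H-profile a)
    ... | right j = trans (codegree-join-ʳ H T j) (cd≡2 j (i≢x ∘ cong (m ↑ʳ_)))

module _ {n} (H : Graph 1) (T : Graph n) (apex-codegree : codegree H zero ≡ 1) where

  join-cone-profile : MatchingProfile T → ConeProfile (join H T)
  join-cone-profile T-profile = zero , trans (codegree-join-ˡ H T zero) apex-codegree , others
    where
    others : ∀ i → i ≢ zero → codegree (join H T) i ≡ 2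
    others zero    i≢0 = contradiction refl i≢0
    others (suc j) _   = trans (codegree-join-ʳ H T j) (T-profile j)

  join-cone-path-profile : PathProfile T → ConePathProfile (join H T)
  join-cone-path-profile (x , cd≡3 , cd≡2) =
    zero , suc x , (λ ()) , trans (codegree-join-ˡ H T zero) apex-codegree , trans (codegree-join-ʳ H T x) cd≡3 , others
    where
    others : ∀ i → i ≢ zero → i ≢ suc x → codegree (join H T) i ≡ 2
    others zero    i≢0 _   = contradiction refl i≢0
    others (suc j) _   j≢x = trans (codegree-join-ʳ H T j) (cd≡2 j (j≢x ∘ cong suc))

completeMinusPM-profile : ∀ k → MatchingProfile (completeMinusPM k)
completeMinusPM-profile zero    ()
completeMinusPM-profile (suc k) i = trans (codegree-≗ (completeMinusPM-join k) i)
  (join-matching-profile (complement (complete 2)) (completeMinusPM k)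
    (λ { zero → refl ; (suc zero) → refl }) (completeMinusPM-profile k) i)

pathComplement-profile : ∀ k → PathProfile (pathComplement k)
pathComplement-profile zero =
  suc zero , refl , λ { zero _ → refl ; (suc zero) 1≢1 → contradiction refl 1≢1 ; (suc (suc zero)) _ → refl }
pathComplement-profile (suc k)
  with x , cd≡3 , cd≡2 ← join-path-profile (complement (complete 2)) (pathComplement k)
                           (λ { zero → refl ; (suc zero) → refl }) (pathComplement-profile k) =
  x , trans (codegree-≗ (pathComplement-join k) x) cd≡3 ,
  λ i i≢x → trans (codegree-≗ (pathComplement-join k) i) (cd≡2 i i≢x)

complete-1-simple : IsSimple (complete 1)
complete-1-simple = (λ { zero zero → refl }) , λ { zero → refl }

complement-complete-2-simple : IsSimple (complement (complete 2))
complement-complete-2-simple =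
    (λ { zero zero → refl ; zero (suc zero) → refl ; (suc zero) zero → refl ; (suc zero) (suc zero) → refl })
  , λ { zero → refl ; (suc zero) → refl }

completeMinusPM-simple : ∀ k → IsSimple (completeMinusPM k)
completeMinusPM-simple zero    = (λ ()) , λ ()
completeMinusPM-simple (suc k) = simple-≗ (completeMinusPM-join k)
  (join-simple (complement (complete 2)) (completeMinusPM k) complement-complete-2-simple (completeMinusPM-simple k))

matching-witness : ∀ k {N} → N ≡ k * 2 → Σ (Graph N) λ W → IsSimple W × MatchingProfile W
matching-witness k refl = completeMinusPM k , completeMinusPM-simple k , completeMinusPM-profile k

cone-witness : ∀ k {N} → N ≡ 1 + suc k * 2 → Σ (Graph N) λ W → IsSimple W × ConeProfile W
cone-witness k refl = join (complete 1) (completeMinusPM (suc k))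
                    , join-simple (complete 1) _ complete-1-simple (completeMinusPM-simple (suc k))
                    , join-cone-profile (complete 1) _ refl (completeMinusPM-profile (suc k))

conePathComplement-codegree-sum : ∀ k → sum (codegree (conePathComplement k)) ≡ (1 + (k * 2 + 3)) * 2
conePathComplement-codegree-sum k =
  trans (sum-cong-≗ (codegree-≗ (complement-union (complete 1) (union (copies k (complete 2)) (path 3)))))
        (cone-path-codegree-sum {G = cone-over-path} (join-cone-path-profile _ _ refl (pathComplement-profile k)))
  where
  cone-over-path : Graph (1 + (k * 2 + 3))
  cone-over-path = join (complement (complete 1)) (pathComplement k)

-- Recognising the extremal graphs by their codegrees

record Peeling {m N} (G : Graph (m + N)) (H : Graph m) : Set where
  field
    σ             : Permutation′ (m + N)
    rest-codegree : ∀ j → codegree (relabel G ((σ ⟨$⟩ʳ_) ∘ (m ↑ʳ_))) j ≡ codegree G (σ ⟨$⟩ʳ (m ↑ʳ j))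
    rest-Iso      : ∀ {n} {T : Graph n} → Iso (relabel G ((σ ⟨$⟩ʳ_) ∘ (m ↑ʳ_))) T → Iso G (join H T)

  σ-injective : Injective _≡_ _≡_ (σ ⟨$⟩ʳ_)
  σ-injective = proj₁ (permutation-bijective σ)

  rest≢prefix : ∀ j a → σ ⟨$⟩ʳ (m ↑ʳ j) ≢ σ ⟨$⟩ʳ (a ↑ˡ N)
  rest≢prefix j a = ↑ˡ≢↑ʳ a j ∘ sym ∘ σ-injective

  rest-preimage : ∀ x → (∀ a → x ≢ σ ⟨$⟩ʳ (a ↑ˡ N)) → Σ (Fin N) λ x′ → σ ⟨$⟩ʳ (m ↑ʳ x′) ≡ x
  rest-preimage x x∉prefix with σ ⟨$⟩ˡ x | inverseʳ σ {x} | split m (σ ⟨$⟩ˡ x)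
  ... | _ | σσ⁻¹x≡x | left a  = contradiction (sym σσ⁻¹x≡x) (x∉prefix a)
  ... | _ | σσ⁻¹x≡x | right j = j , σσ⁻¹x≡x

  rest-path-profile : ∀ x → (∀ a → x ≢ σ ⟨$⟩ʳ (a ↑ˡ N)) → codegree G x ≡ 3 →
    (∀ j → σ ⟨$⟩ʳ (m ↑ʳ j) ≢ x → codegree G (σ ⟨$⟩ʳ (m ↑ʳ j)) ≡ 2) →
    PathProfile (relabel G ((σ ⟨$⟩ʳ_) ∘ (m ↑ʳ_)))
  rest-path-profile x x∉prefix cd≡3 cd≡2 with x′ , σx′≡x ← rest-preimage x x∉prefix =
    x′ , trans (rest-codegree x′) (trans (cong (codegree G) σx′≡x) cd≡3) ,
    λ j j≢x′ → trans (rest-codegree j) (cd≡2 j λ eq → j≢x′ (↑ʳ-injective m _ _ (σ-injective (trans eq (sym σx′≡x)))))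

peeling : ∀ {m N} {G : Graph (m + N)} (H : Graph m) → IsSimple G → (σ : Permutation′ (m + N)) →
  (∀ a b → adj G (σ ⟨$⟩ʳ (a ↑ˡ N)) (σ ⟨$⟩ʳ (b ↑ˡ N)) ≡ adj H a b) →
  (∀ a j → adj G (σ ⟨$⟩ʳ (a ↑ˡ N)) (σ ⟨$⟩ʳ (m ↑ʳ j)) ≡ true) →
  Peeling G H
peeling {m} {N} {G} H simple σ prefix≗H prefix-dominates = record
  { σ             = σ
  ; rest-codegree = λ j →
      trans (sym (codegree-restrict (relabel G (σ ⟨$⟩ʳ_)) j (dominated j))) (codegree-relabel G σ (m ↑ʳ j))
  ; rest-Iso      = λ {_} {T} rest≅T → Iso-trans {K = join H T} (Iso-relabel G σ)
      (join-Iso H {T} (relabel-simple (σ ⟨$⟩ʳ_) simple) prefix≗H prefix-dominates rest≅T)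
  }
  where
  dominated : ∀ j a → adj G (σ ⟨$⟩ʳ (m ↑ʳ j)) (σ ⟨$⟩ʳ (a ↑ˡ N)) ≡ true
  dominated j a = trans (proj₁ simple _ _) (prefix-dominates a j)

apex-peeling : ∀ {N} {G : Graph (1 + N)} (H : Graph 1) → adj H zero zero ≡ false → IsSimple G →
  ∀ c → codegree G c ≡ 1 → Σ (Peeling G H) λ P → Peeling.σ P ⟨$⟩ʳ zero ≡ c
apex-peeling {N} {G} H H-irrefl simple c cd≡1 = peeling H simple τ prefix≗H apex-dominates , transpose-matchˡ zero c
  where
  τ : Permutation′ (1 + N)
  τ = transpose zero c
  prefix≗H : ∀ a b → adj G (τ ⟨$⟩ʳ (a ↑ˡ N)) (τ ⟨$⟩ʳ (b ↑ˡ N)) ≡ adj H a b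
  prefix≗H zero zero = trans (proj₂ simple _) (sym H-irrefl)
  apex-dominates : ∀ a j → adj G (τ ⟨$⟩ʳ (a ↑ˡ N)) (τ ⟨$⟩ʳ (1 ↑ʳ j)) ≡ true
  apex-dominates zero j rewrite transpose-matchˡ zero c = codegree≡1⇒dominating simple c cd≡1 _ rest≢c
    where
    rest≢c : τ ⟨$⟩ʳ suc j ≢ c
    rest≢c eq with () ← proj₁ (permutation-bijective τ) {suc j} {zero} (trans eq (sym (transpose-matchˡ zero c)))

pair-peeling : ∀ {N} {G : Graph (2 + N)} → IsSimple G → ∀ {a b} → a ≢ b → adj G a b ≡ false →
  codegree G a ≡ 2 → codegree G b ≡ 2 →
  Σ (Peeling G (complement (complete 2))) λ P → Peeling.σ P ⟨$⟩ʳ zero ≡ a × Peeling.σ P ⟨$⟩ʳ suc zero ≡ b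
pair-peeling {N} {G} simple {a} {b} a≢b ab cd-a cd-b with σ , σ0≡a , σ1≡b ← permutation-sending a≢b =
  peeling _ simple σ prefix≗H pair-dominates , σ0≡a , σ1≡b
  where
  ba : adj G b a ≡ false
  ba = trans (proj₁ simple b a) ab
  rest≢ : ∀ j p {v} → σ ⟨$⟩ʳ (p ↑ˡ N) ≡ v → σ ⟨$⟩ʳ (2 ↑ʳ j) ≢ v
  rest≢ j p refl = ↑ˡ≢↑ʳ p j ∘ sym ∘ proj₁ (permutation-bijective σ)
  prefix≗H : ∀ p q → adj G (σ ⟨$⟩ʳ (p ↑ˡ N)) (σ ⟨$⟩ʳ (q ↑ˡ N)) ≡ adj (complement (complete 2)) p q
  prefix≗H zero       zero       = proj₂ simple _
  prefix≗H zero       (suc zero) rewrite σ0≡a | σ1≡b = ab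
  prefix≗H (suc zero) zero       rewrite σ0≡a | σ1≡b = ba
  prefix≗H (suc zero) (suc zero) = proj₂ simple _
  pair-dominates : ∀ p j → adj G (σ ⟨$⟩ʳ (p ↑ˡ N)) (σ ⟨$⟩ʳ (2 ↑ʳ j)) ≡ true
  pair-dominates zero j rewrite σ0≡a =
    codegree≡2⇒adjacent simple cd-a (a≢b ∘ sym) ab _ (rest≢ j zero σ0≡a) (rest≢ j (suc zero) σ1≡b)
  pair-dominates (suc zero) j rewrite σ1≡b =
    codegree≡2⇒adjacent simple cd-b a≢b ba _ (rest≢ j (suc zero) σ1≡b) (rest≢ j zero σ0≡a)

matching-Iso : ∀ k {N} → N ≡ k * 2 → (G : Graph N) → IsSimple G → MatchingProfile G → Iso G (completeMinusPM k)
matching-Iso zero    refl G _ _ = (λ ()) , ((λ { {()} }) , λ ()) , λ ()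
matching-Iso (suc k) refl G simple profile
  with b , b≢0 , 0b ← codegree≡2⇒non-neighbour simple zero (profile zero)
  with P , _ ← pair-peeling simple (b≢0 ∘ sym) 0b (profile zero) (profile b) =
  let open Peeling P in
  Iso-trans {K = completeMinusPM (suc k)}
    (rest-Iso (matching-Iso k refl _ (relabel-simple _ simple) (λ j → trans (rest-codegree j) (profile _))))
    (same-adjacency⇒Iso λ i j → sym (completeMinusPM-join k i j))

cone-Iso : ∀ k {N} → N ≡ 1 + suc k * 2 → (G : Graph N) → IsSimple G → ConeProfile G →
  Iso G (join (complete 1) (completeMinusPM (suc k)))
cone-Iso k refl G simple (c , cd≡1 , cd≡2) with P , σ0≡c ← apex-peeling (complete 1) refl simple c cd≡1 =
  let open Peeling P in
  rest-Iso (matching-Iso (suc k) refl _ (relabel-simple _ simple)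
    (λ j → trans (rest-codegree j) (cd≡2 _ λ eq → rest≢prefix j zero (trans eq (sym σ0≡c)))))

-- In order 3 the vertex x of codegree 3 is isolated; once it is moved to vertex 1, the
-- remaining edge 0–2 is forced by the codegree 2 of vertex 0.
path-Iso-base : (G : Graph 3) → IsSimple G → PathProfile G → Iso G (pathComplement 0)
path-Iso-base G simple (x , cd≡3 , cd≡2) =
  Iso-trans {K = pathComplement 0} (Iso-relabel G τ) (same-adjacency⇒Iso G₁≗pathComplement)
  where
  τ : Permutation′ 3
  τ = transpose (suc zero) x
  G₁ : Graph 3
  G₁ = relabel G (τ ⟨$⟩ʳ_)
  simple₁ : IsSimple G₁
  simple₁ = relabel-simple (τ ⟨$⟩ʳ_) simple
  isolated : ∀ j → adj G₁ (suc zero) j ≡ false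
  isolated = codegree≡n⇒isolated simple₁ (suc zero)
    (trans (codegree-relabel G τ (suc zero)) (trans (cong (codegree G) (transpose-matchˡ (suc zero) x)) cd≡3))
  τ0≢x : τ ⟨$⟩ʳ zero ≢ x
  τ0≢x eq with () ← proj₁ (permutation-bijective τ) {zero} {suc zero} (trans eq (sym (transpose-matchˡ (suc zero) x)))
  nonadj₀₁ : adj G₁ zero (suc zero) ≡ false
  nonadj₀₁ = trans (proj₁ simple₁ zero (suc zero)) (isolated zero)
  adj₀₂ : adj G₁ zero (suc (suc zero)) ≡ true
  adj₀₂ = codegree≡2⇒adjacent simple₁ {zero} {suc zero} (trans (codegree-relabel G τ zero) (cd≡2 (τ ⟨$⟩ʳ zero) τ0≢x))
            (λ ()) nonadj₀₁ (suc (suc zero)) (λ ()) (λ ())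
  G₁≗pathComplement : ∀ i j → adj G₁ i j ≡ adj (pathComplement 0) i j
  G₁≗pathComplement zero             zero             = proj₂ simple₁ zero
  G₁≗pathComplement zero             (suc zero)       = nonadj₀₁
  G₁≗pathComplement zero             (suc (suc zero)) = adj₀₂
  G₁≗pathComplement (suc zero)       zero             = isolated zero
  G₁≗pathComplement (suc zero)       (suc zero)       = isolated (suc zero)
  G₁≗pathComplement (suc zero)       (suc (suc zero)) = isolated (suc (suc zero))
  G₁≗pathComplement (suc (suc zero)) zero             = trans (proj₁ simple₁ (suc (suc zero)) zero) adj₀₂
  G₁≗pathComplement (suc (suc zero)) (suc zero)       =
    trans (proj₁ simple₁ (suc (suc zero)) (suc zero)) (isolated (suc (suc zero)))
  G₁≗pathComplement (suc (suc zero)) (suc (suc zero)) = proj₂ simple₁ (suc (suc zero))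
-- A neighbour a of x and the unique non-neighbour b of a both differ from x, so splitting
-- off the pair {a, b} leaves a smaller graph with the same kind of codegree sequence.
path-Iso : ∀ k {N} → N ≡ k * 2 + 3 → (G : Graph N) → IsSimple G → PathProfile G → Iso G (pathComplement k)
path-Iso zero    refl G simple profile = path-Iso-base G simple profile
path-Iso (suc k) refl G simple (x , cd≡3 , cd≡2)
  with a , xa ← codegree<n⇒neighbour simple x
                   (subst (_< suc k * 2 + 3) (sym cd≡3) (s≤s (s≤s (≤-trans (s≤s (s≤s z≤n)) (m≤n+m 3 (k * 2))))))
  = through-neighbour a xa
  where
  neighbour≢x : ∀ {a} → adj G x a ≡ true → a ≢ x
  neighbour≢x xa refl = contradiction (trans (sym xa) (proj₂ simple x)) λ ()
  non-neighbour≢x : ∀ {a b} → adj G x a ≡ true → adj G a b ≡ false → b ≢ x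
  non-neighbour≢x {a} xa ab refl = contradiction (trans (sym xa) (trans (proj₁ simple x a) ab)) λ ()
  through-neighbour : ∀ a → adj G x a ≡ true → Iso G (pathComplement (suc k))
  through-neighbour a xa with b , b≢a , ab ← codegree≡2⇒non-neighbour simple a (cd≡2 a (neighbour≢x xa))
    with P , σ0≡a , σ1≡b ← pair-peeling simple (b≢a ∘ sym) ab (cd≡2 a (neighbour≢x xa))
                                        (cd≡2 b (non-neighbour≢x xa ab)) =
    let open Peeling P in
    Iso-trans {K = pathComplement (suc k)}
      (rest-Iso (path-Iso k refl _ (relabel-simple _ simple) (rest-path-profile x
        (λ { zero       eq → neighbour≢x xa (trans (sym σ0≡a) (sym eq))
           ; (suc zero) eq → non-neighbour≢x xa ab (trans (sym σ1≡b) (sym eq)) })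
        cd≡3 (λ j → cd≡2 _))))
      (same-adjacency⇒Iso λ i j → sym (pathComplement-join k i j))

cone-path-Iso : ∀ k {N} → N ≡ 1 + (k * 2 + 3) → (G : Graph N) → IsSimple G → ConePathProfile G →
  Iso G (conePathComplement k)
cone-path-Iso k refl G simple (c , x , x≢c , cd≡1 , cd≡3 , cd≡2)
  with P , σ0≡c ← apex-peeling (complement (complete 1)) refl simple c cd≡1 =
  let open Peeling P in
  Iso-trans {K = conePathComplement k}
    (rest-Iso (path-Iso k refl _ (relabel-simple _ simple) (rest-path-profile x
      (λ { zero eq → x≢c (trans eq σ0≡c) }) cd≡3 (λ j → cd≡2 _ λ eq → rest≢prefix j zero (trans eq (sym σ0≡c))))))
    (same-adjacency⇒Iso λ i j → sym (complement-union (complete 1) (union (copies k (complete 2)) (path 3)) i j))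

-- Extremality

even-extremal-structure : ∀ k {n} → n ≡ suc (suc k) * 2 → (G : Graph n) → IsSimple G →
  AtMostOneDominating G →
  sum (codegree G) ≡ n * 2 ⇔ (Iso G (completeMinusPM (suc (suc k))) ⊎ Iso G (conePathComplement k))
even-extremal-structure k {n} n≡ G simple unique = mk⇔ to from
  where
  to : sum (codegree G) ≡ n * 2 → Iso G (completeMinusPM (suc (suc k))) ⊎ Iso G (conePathComplement k)
  to tight with codegree-sum-tight-even simple unique tight
  ... | inj₁ matching  = inj₁ (matching-Iso (suc (suc k)) n≡ G simple matching)
  ... | inj₂ cone-path = inj₂ (cone-path-Iso k (trans n≡ (reorder k)) G simple cone-path)
    where
    reorder : ∀ k → suc (suc k) * 2 ≡ 1 + (k * 2 + 3)
    reorder = solve-∀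
  from : Iso G (completeMinusPM (suc (suc k))) ⊎ Iso G (conePathComplement k) → sum (codegree G) ≡ n * 2
  from (inj₁ G≅T) = Iso⇒codegree-sum≡2n {G = G} {completeMinusPM (suc (suc k))} G≅T
    (matching-codegree-sum {G = completeMinusPM (suc (suc k))} (completeMinusPM-profile (suc (suc k))))
  from (inj₂ G≅T) = Iso⇒codegree-sum≡2n {G = G} {conePathComplement k} G≅T (conePathComplement-codegree-sum k)

odd-extremal-structure : ∀ k {n} → n ≡ 1 + suc k * 2 → (G : Graph n) → IsSimple G →
  AtMostOneDominating G →
  ∀ s → s + 1 ≡ n * 2 → sum (codegree G) ≡ s ⇔ Iso G (join (complete 1) (completeMinusPM (suc k)))
odd-extremal-structure k n≡ G simple unique s s+1≡2n = mk⇔ to from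
  where
  T : Graph (1 + suc k * 2)
  T = join (complete 1) (completeMinusPM (suc k))
  to : sum (codegree G) ≡ s → Iso G T
  to Σ≡s = cone-Iso k n≡ G simple
    (codegree-sum-tight-odd simple unique (≤-reflexive (trans (cong (_+ 1) Σ≡s) s+1≡2n)))
  from : Iso G T → sum (codegree G) ≡ s
  from G≅T = +-cancelʳ-≡ 1 _ _ (trans (cong (_+ 1) (codegree-sum-Iso {G = G} {T} G≅T))
    (trans (cone-codegree-sum {G = T} (join-cone-profile (complete 1) _ refl (completeMinusPM-profile (suc k))))
           (trans (cong (_* 2) (sym (Iso⇒order≡ {G = G} {T} G≅T))) (sym s+1≡2n))))

even-order : ∀ {p} k → p ≡ 2 * suc k → p + 2 ≡ suc (suc k) * 2
even-order k refl = arithmetic k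
  where
  arithmetic : ∀ k → 2 * suc k + 2 ≡ suc (suc k) * 2
  arithmetic = solve-∀

odd-order : ∀ {p} k → p ≡ 2 * k + 1 → p + 2 ≡ 1 + suc k * 2
odd-order k refl = arithmetic k
  where
  arithmetic : ∀ k → 2 * k + 1 + 2 ≡ 1 + suc k * 2
  arithmetic = solve-∀

module _ {p} {G : Graph (p + 2)} (simple : IsSimple G) (book-free : ¬ Contains (book p) G) where

  private
    at-most-one : ∀ {G′ : Graph (p + 2)} → IsSimple G′ → (¬ Contains (book p) G′) ⇔ AtMostOneDominating G′
    at-most-one {G′} simple′ = book-free⇔at-most-one-dominating (+-comm 2 p) G′ simple′

  extremal⇔minimal-codegree-sum : ∀ {s} →
    (∀ (G′ : Graph (p + 2)) → IsSimple G′ → ¬ Contains (book p) G′ → s ≤ sum (codegree G′)) →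
    (W : Graph (p + 2)) → IsSimple W → ¬ Contains (book p) W → sum (codegree W) ≡ s →
    HasExSize (book p) G ⇔ sum (codegree G) ≡ s
  extremal⇔minimal-codegree-sum {s} minimal W W-simple W-free Σ-W = mk⇔ to from
    where
    to : HasExSize (book p) G → sum (codegree G) ≡ s
    to extremal = ≤-antisym
      (≤-trans (Equivalence.to (size-≤⇔codegree-sum-≥ simple W-simple) (extremal W W-simple W-free)) (≤-reflexive Σ-W))
      (minimal G simple book-free)
    from : sum (codegree G) ≡ s → HasExSize (book p) G
    from Σ-G G′ G′-simple G′-free = Equivalence.from (size-≤⇔codegree-sum-≥ simple G′-simple)
      (subst (_≤ sum (codegree G′)) (sym Σ-G) (minimal G′ G′-simple G′-free))

  even-extremal : ∀ k → p ≡ 2 * suc k →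
    HasExSize (book p) G ⇔ (Iso G (completeMinusPM (suc (suc k))) ⊎ Iso G (conePathComplement k))
  even-extremal k p≡2k with W , W-simple , W-profile ← matching-witness (suc (suc k)) (even-order k p≡2k) =
    even-extremal-structure k (even-order k p≡2k) G simple (Equivalence.to (at-most-one simple) book-free)
    ⇔-∘ extremal⇔minimal-codegree-sum
          (λ G′ simple′ free′ → codegree-sum-lower-bound-even simple′ (Equivalence.to (at-most-one simple′) free′)
                                   (suc (suc k)) (trans (even-order k p≡2k) (*-comm _ 2)))
          W W-simple (Equivalence.from (at-most-one W-simple) (matching-profile⇒no-dominating W-simple W-profile))
          (matching-codegree-sum W-profile)

  odd-extremal : ∀ k → p ≡ 2 * k + 1 → HasExSize (book p) G ⇔ Iso G (join (complete 1) (completeMinusPM (suc k)))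
  odd-extremal k p≡2k+1 with W , W-simple , W-profile ← cone-witness k (odd-order k p≡2k+1) =
    odd-extremal-structure k (odd-order k p≡2k+1) G simple (Equivalence.to (at-most-one simple) book-free)
      (sum (codegree W)) (cone-codegree-sum W-profile)
    ⇔-∘ extremal⇔minimal-codegree-sum
          (λ G′ simple′ free′ → +-cancelʳ-≤ 1 _ (sum (codegree G′)) (≤-trans (≤-reflexive (cone-codegree-sum W-profile))
             (codegree-sum-lower-bound simple′ (Equivalence.to (at-most-one simple′) free′))))
          W W-simple (Equivalence.from (at-most-one W-simple) (cone-profile⇒one-dominating W-simple W-profile))
          refl

theorem4 : (p : ℕ) → 1 ≤ p → (G : Graph (p + 2)) → IsSimple G → ¬ Contains (book p) G →
    ((k : ℕ) → p ≡ 2 * k →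
      (HasExSize (book p) G ⇔
        (Iso G (completeMinusPM (suc k))
          ⊎ Iso G (complement (union (complete 1) (union (copies (k ∸ 1) (complete 2)) (path 3)))))))
    × ((k : ℕ) → p ≡ 2 * k + 1 →
      (HasExSize (book p) G ⇔ Iso G (join (complete 1) (completeMinusPM (suc k)))))
theorem4 p 1≤p G simple book-free = even , odd-extremal simple book-free
  where
  even : (k : ℕ) → p ≡ 2 * k →
    HasExSize (book p) G ⇔ (Iso G (completeMinusPM (suc k)) ⊎ Iso G (conePathComplement (k ∸ 1)))
  even zero    p≡0  = contradiction (subst (1 ≤_) p≡0 1≤p) λ ()
  even (suc k) p≡2k = even-extremal simple book-free k p≡2k
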